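{- Let $D$ be a diagram and $D_1,D_2\in\mathcal{P}(D)$ with $D_2\prec D_1$. Suppose there exist integers $0<c_1<c_2<\cdots<c_n$ and, for each $1\le i\le n$, integers $0<r^i_1<r^i_2$, such that, with $R=\bigcup_{i=1}^n\{(\tilde r,c_i)\mid r^i_1\le\tilde r\le r^i_2\}$, we have $S:=D_1\setminus R=D_2\setminus R$. Then $\tilde D\setminus R=S$ for every $\tilde D\in[D_2,D_1]$.
   Context: A diagram is a finite set of cells in $\mathbb{Z}_{>0}\times\mathbb{Z}_{>0}$; a cell $(r,c)$ lies in row $r$ (rows numbered from the bottom, starting at $1$) and column $c$. Applying a Kohnert move at row $r$ of a diagram $D$: if row $r$ is nonempty, let $(r,c)$ be its rightmost cell; if there is $r'$ with $1\le r'<r$ and $(r',c)\notin D$, take the largest such $r'$ and replace $(r,c)$ by $(r',c)$; otherwise $D$ is unchanged. The Kohnert poset $\mathcal{P}(D)$ is the set of diagrams obtainable from $D$ by finite (possibly empty) sequences of Kohnert moves, with $D_2\preceq D_1$ iff $D_2$ can be obtained from $D_1$ by Kohnert moves; $[D_2,D_1]=\{\tilde D\in\mathcal{P}(D)\mid D_2\preceq\tilde D\preceq D_1\}$. -}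

module Defs where

open import Data.Nat using (ℕ; zero; suc; _≤_; _<_; _⊔_; _∸_)
open import Data.Nat.Properties using (_≟_)
open import Data.Product using (_×_; _,_; proj₁; proj₂; Σ; ∃)
open import Data.Product.Properties using (≡-dec)
open import Data.List using (List; []; _∷_; map; filter; foldr)
open import Data.List.Membership.Propositional using (_∈_)
open import Data.List.Membership.DecPropositional (≡-dec _≟_ _≟_) using (_∈?_)
open import Data.Maybe using (Maybe; just; nothing)
open import Data.Fin using (Fin)
open import Relation.Nullary using (¬_; yes; no; ¬?)
open import Relation.Binary.PropositionalEquality using (_≡_)
open import Function.Bundles using (_⇔_)

-- A cell (r , c): row r (counted from the bottom, starting at 1), column c.
Cell : Set
Cell = ℕ × ℕ

-- A diagram is a finite set of cells, represented by a list; two lists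
-- represent the same diagram iff they have the same members.
Diagram : Set
Diagram = List Cell

Positive : Diagram → Set
Positive D = ∀ {r c} → (r , c) ∈ D → 1 ≤ r × 1 ≤ c

_≈_ : Diagram → Diagram → Set
D ≈ E = ∀ x → (x ∈ D) ⇔ (x ∈ E)

rowCols : ℕ → Diagram → List ℕ
rowCols r D = map proj₂ (filter (λ x → proj₁ x ≟ r) D)

largestFree : Diagram → ℕ → ℕ → Maybe ℕ
largestFree D c zero = nothing
largestFree D c (suc k) with (suc k , c) ∈? D
... | yes _ = largestFree D c k
... | no  _ = just (suc k)

kohnert : ℕ → Diagram → Diagram
kohnert r D with rowCols r D
... | [] = D
... | c ∷ cs with largestFree D (foldr _⊔_ c cs) (r ∸ 1)
...   | nothing = D
...   | just r' = (r' , foldr _⊔_ c cs) ∷ filter (λ x → ¬? (≡-dec _≟_ _≟_ x (r , foldr _⊔_ c cs))) D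

data _⇝_ : Diagram → Diagram → Set where
  done : ∀ {D E} → D ≈ E → D ⇝ E
  move : ∀ {D E} (r : ℕ) → kohnert r D ⇝ E → D ⇝ E

_∈𝒫_ : Diagram → Diagram → Set
E ∈𝒫 D = D ⇝ E

_⪯_ : Diagram → Diagram → Set
D₂ ⪯ D₁ = D₁ ⇝ D₂

_≺_ : Diagram → Diagram → Set
D₂ ≺ D₁ = D₂ ⪯ D₁ × ¬ (D₂ ≈ D₁)

InInterval : Diagram → Diagram → Diagram → Diagram → Set
InInterval D D₂ D₁ E = E ∈𝒫 D × D₂ ⪯ E × E ⪯ D₁

InR : (n : ℕ) → (Fin n → ℕ) → (Fin n → ℕ) → (Fin n → ℕ) → Cell → Set
InR n c r₁ r₂ (r , col) = Σ (Fin n) λ i → col ≡ c i × r₁ i ≤ r × r ≤ r₂ i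

_∖_ : Diagram → (Cell → Set) → Cell → Set
(D ∖ R) x = x ∈ D × ¬ R x

_≐_ : (Cell → Set) → (Cell → Set) → Set
P ≐ Q = ∀ x → P x ⇔ Q x

-- Fix a column and a row bound B above every cell of D₁, and count the cells of a diagram in that
-- column at rows ≥ t. A Kohnert move shifts one cell down, so along D₁ ⇝ E ⇝ D₂ these counts can
-- only decrease, while the total count of the column stays fixed. Since the cs are distinct, R meets
-- each column in an interval, so a cell (ρ , col) ∉ R lies either above it, where D₁ and D₂ agree at
-- all rows ≥ ρ, or below it, where they agree at all rows ≤ ρ and hence (using the totals) have the
-- same counts at rows ≥ ρ and ≥ ρ + 1. In both cases E is squeezed to the counts of D₁ at ρ and
-- ρ + 1, and their difference decides whether (ρ , col) ∈ E.
module Submission where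

open import Defs
open import Data.Nat using (ℕ; zero; suc; _≤_; _<_; _⊔_; _∸_; _+_; z≤n; s≤s; s≤s⁻¹; _<?_; _≤?_)
open import Data.Nat.Properties
open import Algebra.Properties.CommutativeSemigroup +-commutativeSemigroup using (interchange)
open import Data.Fin using (Fin)
open import Data.Fin.Properties using (any?) renaming (<-cmp to Fin-<-cmp)
open import Data.Product using (_×_; _,_; proj₁; proj₂; Σ)
open import Data.Product.Properties using (≡-dec)
open import Data.Sum using (_⊎_; inj₁; inj₂; [_,_]′) renaming (map to ⊎-map)
open import Data.Empty using (⊥-elim)
open import Data.List using ([]; _∷_; [_]; filter; foldr)
open import Data.List.Relation.Unary.Any using (here; there)
open import Data.List.Membership.Propositional using (_∈_; _∉_)
open import Data.List.Membership.DecPropositional (≡-dec _≟_ _≟_) using (_∈?_)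
open import Data.List.Membership.Propositional.Properties using (∈-map⁻; ∈-filter⁻; ∈-filter⁺)
open import Data.Maybe using (just; nothing)
open import Function.Bundles using (_⇔_; mk⇔; Equivalence)
open import Function.Definitions using (Injective)
open import Function.Properties.Equivalence using () renaming (sym to ⇔-sym)
open import Relation.Binary.Definitions using (tri<; tri≈; tri>)
open import Relation.Nullary using (¬_; ¬?; Dec; yes; no)
open import Relation.Binary.PropositionalEquality hiding ([_])
open ≡-Reasoning

-- Counting cells through membership indicators, not list lengths, makes counts insensitive to
-- duplicate entries, hence invariant under ≈.
χ : Diagram → Cell → ℕ
χ D x with x ∈? D
... | yes _ = 1
... | no _  = 0

χ-∈ : ∀ {D x} → x ∈ D → χ D x ≡ 1
χ-∈ {D} {x} x∈D with x ∈? D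
... | yes _   = refl
... | no x∉D  = ⊥-elim (x∉D x∈D)

χ-∉ : ∀ {D x} → x ∉ D → χ D x ≡ 0
χ-∉ {D} {x} x∉D with x ∈? D
... | yes x∈D = ⊥-elim (x∉D x∈D)
... | no _    = refl

χ-cong : ∀ {D E x} → (x ∈ D ⇔ x ∈ E) → χ D x ≡ χ E x
χ-cong {D} {E} {x} D⇔E with x ∈? D
... | yes x∈D = sym (χ-∈ (Equivalence.to D⇔E x∈D))
... | no x∉D  = sym (χ-∉ (λ x∈E → x∉D (Equivalence.from D⇔E x∈E)))

χ-≡⇒∈ : ∀ {D E x} → χ D x ≡ χ E x → x ∈ D → x ∈ E
χ-≡⇒∈ {D} {E} {x} eq x∈D = decide (x ∈? E)
  where
  decide : Dec (x ∈ E) → x ∈ E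
  decide (yes x∈E) = x∈E
  decide (no x∉E)  = ⊥-elim (1+n≢0 (trans (sym (χ-∈ x∈D)) (trans eq (χ-∉ x∉E))))

χ-≡⇒⇔ : ∀ {D E x} → χ D x ≡ χ E x → x ∈ D ⇔ x ∈ E
χ-≡⇒⇔ eq = mk⇔ (χ-≡⇒∈ eq) (χ-≡⇒∈ (sym eq))

χ-[]-≢ : ∀ {x y : Cell} → x ≢ y → χ [ y ] x ≡ 0
χ-[]-≢ x≢y = χ-∉ λ { (here x≡y) → x≢y x≡y }

sumFrom : (ℕ → ℕ) → ℕ → ℕ → ℕ
sumFrom g a zero    = 0
sumFrom g a (suc k) = g a + sumFrom g (suc a) k

sumFrom-cong : ∀ {g h} a k → (∀ j → a ≤ j → j < a + k → g j ≡ h j) →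
               sumFrom g a k ≡ sumFrom h a k
sumFrom-cong a zero    g≡h = refl
sumFrom-cong a (suc k) g≡h =
  cong₂ _+_ (g≡h a ≤-refl (subst (a <_) (sym (+-suc a k)) (s≤s (m≤m+n a k))))
            (sumFrom-cong (suc a) k λ j a<j j<a+1+k →
              g≡h j (<⇒≤ a<j) (subst (j <_) (sym (+-suc a k)) j<a+1+k))

sumFrom-+ : ∀ g h a k → sumFrom (λ j → g j + h j) a k ≡ sumFrom g a k + sumFrom h a k
sumFrom-+ g h a zero    = refl
sumFrom-+ g h a (suc k) = begin
  (g a + h a) + sumFrom (λ j → g j + h j) (suc a) k
    ≡⟨ cong ((g a + h a) +_) (sumFrom-+ g h (suc a) k) ⟩
  (g a + h a) + (sumFrom g (suc a) k + sumFrom h (suc a) k)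
    ≡⟨ interchange (g a) (h a) _ _ ⟩
  (g a + sumFrom g (suc a) k) + (h a + sumFrom h (suc a) k)
    ∎

sumFrom-++ : ∀ g a m n → sumFrom g a (m + n) ≡ sumFrom g a m + sumFrom g (a + m) n
sumFrom-++ g a zero    n = cong (λ b → sumFrom g b n) (sym (+-identityʳ a))
sumFrom-++ g a (suc m) n = begin
  g a + sumFrom g (suc a) (m + n)
    ≡⟨ cong (g a +_) (sumFrom-++ g (suc a) m n) ⟩
  g a + (sumFrom g (suc a) m + sumFrom g (suc a + m) n)
    ≡⟨ sym (+-assoc (g a) _ _) ⟩
  g a + sumFrom g (suc a) m + sumFrom g (suc a + m) n
    ≡⟨ cong (λ b → g a + sumFrom g (suc a) m + sumFrom g b n) (sym (+-suc a m)) ⟩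
  g a + sumFrom g (suc a) m + sumFrom g (a + suc m) n
    ∎

sumFrom-zero : ∀ {g} a k → (∀ j → a ≤ j → g j ≡ 0) → sumFrom g a k ≡ 0
sumFrom-zero a zero    g≡0 = refl
sumFrom-zero a (suc k) g≡0 =
  cong₂ _+_ (g≡0 a ≤-refl) (sumFrom-zero (suc a) k λ j a<j → g≡0 j (<⇒≤ a<j))

sumFrom-point : ∀ {g} p a k → (∀ j → j ≢ p → g j ≡ 0) → a ≤ p → p < a + k → sumFrom g a k ≡ g p
sumFrom-point p a zero g≡0 a≤p p<a+0 =
  ⊥-elim (<⇒≱ (subst (p <_) (+-identityʳ a) p<a+0) a≤p)
sumFrom-point {g} p a (suc k) g≡0 a≤p p<a+1+k with a ≟ p
... | yes refl = trans (cong (g a +_) (sumFrom-zero (suc a) k λ j a<j → g≡0 j (≢-sym (<⇒≢ a<j))))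
                       (+-identityʳ (g a))
... | no a≢p   = trans (cong (_+ sumFrom g (suc a) k) (g≡0 a a≢p))
                       (sumFrom-point p (suc a) k g≡0 (≤∧≢⇒< a≤p a≢p) (subst (p <_) (+-suc a k) p<a+1+k))

foldr-⊔-∈ : ∀ c cs → foldr _⊔_ c cs ∈ c ∷ cs
foldr-⊔-∈ c []       = here refl
foldr-⊔-∈ c (x ∷ xs) with ⊔-sel x (foldr _⊔_ c xs)
... | inj₁ eq = there (here eq)
... | inj₂ eq with foldr-⊔-∈ c xs
...   | here  p = here (trans eq p)
...   | there p = there (there (subst (_∈ xs) (sym eq) p))

largestFree-sound : ∀ D c k {r} → largestFree D c k ≡ just r → 0 < r × r ≤ k × (r , c) ∉ D
largestFree-sound D c zero    ()
largestFree-sound D c (suc k) eq with (suc k , c) ∈? D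
... | yes _ = let (0<r , r≤k , r∉D) = largestFree-sound D c k eq in 0<r , m≤n⇒m≤1+n r≤k , r∉D
... | no c∉D with eq
...   | refl = s≤s z≤n , ≤-refl , c∉D

0<m≤n∸1⇒m<n : ∀ {m} n → 0 < m → m ≤ n ∸ 1 → m < n
0<m≤n∸1⇒m<n zero    (s≤s z≤n) ()
0<m≤n∸1⇒m<n (suc n) _         m≤n = s≤s m≤n

record KohnertStep (D D′ : Diagram) : Set where
  field
    r r′ c : ℕ
    r∈D    : (r , c) ∈ D
    r′∉D   : (r′ , c) ∉ D
    r′<r   : r′ < r
    ∈D′    : ∀ x → x ∈ D′ ⇔ (x ≡ (r′ , c) ⊎ (x ∈ D × x ≢ (r , c)))

kohnert-step : ∀ r D → kohnert r D ≈ D ⊎ KohnertStep D (kohnert r D)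
kohnert-step r D with rowCols r D in rowEq
... | [] = inj₁ λ _ → mk⇔ (λ x∈ → x∈) (λ x∈ → x∈)
... | c ∷ cs with largestFree D (foldr _⊔_ c cs) (r ∸ 1) in freeEq
...   | nothing = inj₁ λ _ → mk⇔ (λ x∈ → x∈) (λ x∈ → x∈)
...   | just r′ = inj₂ record
  { r = r ; r′ = r′ ; c = m ; r∈D = r∈D ; r′∉D = r′∉D ; r′<r = r′<r
  ; ∈D′ = λ _ → mk⇔ to′ from′ }
  where
  m = foldr _⊔_ c cs
  keep = λ (x : Cell) → ¬? (≡-dec _≟_ _≟_ x (r , m))
  free = largestFree-sound D m (r ∸ 1) freeEq
  r′∉D = proj₂ (proj₂ free)
  r′<r : r′ < r
  r′<r = 0<m≤n∸1⇒m<n r (proj₁ free) (proj₁ (proj₂ free))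
  r∈D : (r , m) ∈ D
  r∈D with ∈-map⁻ proj₂ (subst (m ∈_) (sym rowEq) (foldr-⊔-∈ c cs))
  ... | _ , x∈ , refl with ∈-filter⁻ (λ x → proj₁ x ≟ r) x∈
  ...   | x∈D , refl = x∈D
  to′ : ∀ {x} → x ∈ (r′ , m) ∷ filter keep D → x ≡ (r′ , m) ⊎ (x ∈ D × x ≢ (r , m))
  to′ (here eq) = inj₁ eq
  to′ (there x∈) = inj₂ (∈-filter⁻ keep x∈)
  from′ : ∀ {x} → x ≡ (r′ , m) ⊎ (x ∈ D × x ≢ (r , m)) → x ∈ (r′ , m) ∷ filter keep D
  from′ (inj₁ eq) = here eq
  from′ (inj₂ (x∈D , x≢)) = there (∈-filter⁺ keep x∈D x≢)

module _ {D D′ : Diagram} (step : KohnertStep D D′) where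
  open KohnertStep step

  r∉D′ : (r , c) ∉ D′
  r∉D′ r∈D′ with Equivalence.to (∈D′ _) r∈D′
  ... | inj₁ eq        = <-irrefl (sym (cong proj₁ eq)) r′<r
  ... | inj₂ (_ , r≢r) = r≢r refl

  χ-balance : ∀ x → χ D x + χ [ (r′ , c) ] x ≡ χ D′ x + χ [ (r , c) ] x
  χ-balance x = byCases (x ≟ᶜ (r , c)) (x ≟ᶜ (r′ , c))
    where
    _≟ᶜ_ = ≡-dec _≟_ _≟_
    r′≢r : (r′ , c) ≢ (r , c)
    r′≢r eq = <-irrefl (cong proj₁ eq) r′<r
    byCases : Dec (x ≡ (r , c)) → Dec (x ≡ (r′ , c)) →
              χ D x + χ [ (r′ , c) ] x ≡ χ D′ x + χ [ (r , c) ] x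
    byCases (yes refl) _ =
      trans (cong₂ _+_ (χ-∈ r∈D) (χ-[]-≢ (≢-sym r′≢r)))
            (sym (cong₂ _+_ (χ-∉ r∉D′) (χ-∈ (here refl))))
    byCases (no _) (yes refl) =
      trans (cong₂ _+_ (χ-∉ r′∉D) (χ-∈ (here refl)))
            (sym (cong₂ _+_ (χ-∈ (Equivalence.from (∈D′ _) (inj₁ refl))) (χ-[]-≢ r′≢r)))
    byCases (no x≢r) (no x≢r′) =
      cong₂ _+_ (χ-cong (mk⇔ x∈D⇒x∈D′ x∈D′⇒x∈D))
                (trans (χ-[]-≢ x≢r′) (sym (χ-[]-≢ x≢r)))
      where
      x∈D⇒x∈D′ : x ∈ D → x ∈ D′
      x∈D⇒x∈D′ x∈D = Equivalence.from (∈D′ x) (inj₂ (x∈D , x≢r))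
      x∈D′⇒x∈D : x ∈ D′ → x ∈ D
      x∈D′⇒x∈D x∈D′ with Equivalence.to (∈D′ x) x∈D′
      ... | inj₁ x≡r′      = ⊥-elim (x≢r′ x≡r′)
      ... | inj₂ (x∈D , _) = x∈D

column : Diagram → ℕ → ℕ → ℕ
column X col j = χ X (j , col)

colCount : ℕ → ℕ → ℕ → Diagram → ℕ
colCount B col t X = sumFrom (column X col) t (B ∸ t)

colCount-≈ : ∀ {X Y} B col t → X ≈ Y → colCount B col t X ≡ colCount B col t Y
colCount-≈ B col t X≈Y = sumFrom-cong t (B ∸ t) λ j _ _ → χ-cong (X≈Y (j , col))

colCount-+ : ∀ B col t X Y →
  sumFrom (λ j → column X col j + column Y col j) t (B ∸ t) ≡ colCount B col t X + colCount B col t Y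
colCount-+ B col t X Y = sumFrom-+ (column X col) (column Y col) t (B ∸ t)

colCount-suc : ∀ {B ρ} col X → ρ < B →
               colCount B col ρ X ≡ χ X (ρ , col) + colCount B col (suc ρ) X
colCount-suc {ρ = ρ} col X ρ<B = cong (sumFrom (column X col) ρ) (+-∸-assoc 1 ρ<B)

colCount-prefix : ∀ {B t} col X → t ≤ B →
                  colCount B col 0 X ≡ sumFrom (column X col) 0 t + colCount B col t X
colCount-prefix {B} {t} col X t≤B = begin
  sumFrom (column X col) 0 B              ≡⟨ cong (sumFrom (column X col) 0) (sym (m+[n∸m]≡n t≤B)) ⟩
  sumFrom (column X col) 0 (t + (B ∸ t))  ≡⟨ sumFrom-++ (column X col) 0 t (B ∸ t) ⟩
  sumFrom (column X col) 0 t + colCount B col t X  ∎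

colCount-[]-zero : ∀ B col t {p m} → col ≢ m ⊎ p < t → colCount B col t [ (p , m) ] ≡ 0
colCount-[]-zero B col t outside = sumFrom-zero t (B ∸ t) λ j t≤j → χ-[]-≢ (off t≤j outside)
  where
  off : ∀ {j p m} → t ≤ j → col ≢ m ⊎ p < t → (j , col) ≢ (p , m)
  off _   (inj₁ col≢m) refl = col≢m refl
  off t≤j (inj₂ p<t)   refl = <-irrefl refl (<-≤-trans p<t t≤j)

colCount-[]-one : ∀ {B t p} m → t ≤ p → p < B → colCount B m t [ (p , m) ] ≡ 1
colCount-[]-one {B} {t} {p} m t≤p p<B = trans
  (sumFrom-point p t (B ∸ t) (λ j j≢p → χ-[]-≢ λ eq → j≢p (cong proj₁ eq)) t≤p
                 (<-≤-trans p<B (m≤n+m∸n B t)))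
  (χ-∈ (here refl))

colCount-[]-lower : ∀ {B a b} col t m → a < b → b < B →
                    colCount B col t [ (a , m) ] ≤ colCount B col t [ (b , m) ]
colCount-[]-lower {B} {a} col t m a<b b<B with col ≟ m | t ≤? a
... | no col≢m | _       = ≤-trans (≤-reflexive (colCount-[]-zero B col t (inj₁ col≢m))) z≤n
... | yes refl | no t≰a  = ≤-trans (≤-reflexive (colCount-[]-zero B col t (inj₂ (≰⇒> t≰a)))) z≤n
... | yes refl | yes t≤a = ≤-reflexive (trans (colCount-[]-one col t≤a (<-trans a<b b<B))
                                               (sym (colCount-[]-one col (≤-trans t≤a (<⇒≤ a<b)) b<B)))

colCount-[]-total : ∀ {B a b} col m → a < B → b < B →
                    colCount B col 0 [ (a , m) ] ≡ colCount B col 0 [ (b , m) ]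
colCount-[]-total {B} col m a<B b<B with col ≟ m
... | no col≢m = trans (colCount-[]-zero B col 0 (inj₁ col≢m))
                      (sym (colCount-[]-zero B col 0 (inj₁ col≢m)))
... | yes refl = trans (colCount-[]-one col z≤n a<B) (sym (colCount-[]-one col z≤n b<B))

Bounded : ℕ → Diagram → Set
Bounded B X = ∀ {r c} → (r , c) ∈ X → r < B

bound : ∀ X → Σ ℕ λ B → Bounded B X
bound []            = 0 , λ ()
bound ((r , c) ∷ X) with bound X
... | B , X<B = suc r ⊔ B , λ { (here refl)  → m≤m⊔n (suc r) B
                              ; (there x∈X) → <-≤-trans (X<B x∈X) (m≤n⊔m (suc r) B) }

record Descent (B : ℕ) (X Y : Diagram) : Set where
  field
    bounded        : Bounded B Y
    colCount-≤     : ∀ col t → colCount B col t Y ≤ colCount B col t X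
    colCount-total : ∀ col → colCount B col 0 Y ≡ colCount B col 0 X
open Descent

Descent-≈ : ∀ {B X Y} → Bounded B X → X ≈ Y → Descent B X Y
Descent-≈ {B} X<B X≈Y = record
  { bounded        = λ x∈Y → X<B (Equivalence.from (X≈Y _) x∈Y)
  ; colCount-≤     = λ col t → ≤-reflexive (sym (colCount-≈ B col t X≈Y))
  ; colCount-total = λ col → sym (colCount-≈ B col 0 X≈Y)
  }

Descent-trans : ∀ {B X Y Z} → Descent B X Y → Descent B Y Z → Descent B X Z
Descent-trans X↘Y Y↘Z = record
  { bounded        = bounded Y↘Z
  ; colCount-≤     = λ col t → ≤-trans (colCount-≤ Y↘Z col t) (colCount-≤ X↘Y col t)
  ; colCount-total = λ col → trans (colCount-total Y↘Z col) (colCount-total X↘Y col)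
  }

KohnertStep-descent : ∀ {B D D′} → Bounded B D → KohnertStep D D′ → Descent B D D′
KohnertStep-descent {B} {D} {D′} D<B step = record
  { bounded        = D′<B
  ; colCount-≤     = λ col t → +-cancelʳ-≤ (count [ (r , c) ] col t) _ _
      (subst (_≤ count D col t + count [ (r , c) ] col t) (balance col t)
             (+-monoʳ-≤ (count D col t) (colCount-[]-lower col t c r′<r r<B)))
  ; colCount-total = λ col → +-cancelʳ-≡ (count [ (r , c) ] col 0) _ _ (begin
      count D′ col 0 + count [ (r , c) ] col 0   ≡⟨ sym (balance col 0) ⟩
      count D col 0 + count [ (r′ , c) ] col 0   ≡⟨ cong (count D col 0 +_) (colCount-[]-total col c r′<B r<B) ⟩
      count D col 0 + count [ (r , c) ] col 0    ∎)
  }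
  where
  open KohnertStep step
  count : Diagram → ℕ → ℕ → ℕ
  count X col t = colCount B col t X
  r<B  = D<B r∈D
  r′<B = <-trans r′<r r<B
  D′<B : Bounded B D′
  D′<B x∈D′ with Equivalence.to (∈D′ _) x∈D′
  ... | inj₁ refl      = r′<B
  ... | inj₂ (x∈D , _) = D<B x∈D
  balance : ∀ col t → count D col t + count [ (r′ , c) ] col t ≡ count D′ col t + count [ (r , c) ] col t
  balance col t = begin
    count D col t + count [ (r′ , c) ] col t
      ≡⟨ sym (colCount-+ B col t D _) ⟩
    sumFrom (λ j → column D col j + column [ (r′ , c) ] col j) t (B ∸ t)
      ≡⟨ sumFrom-cong t (B ∸ t) (λ j _ _ → χ-balance step (j , col)) ⟩
    sumFrom (λ j → column D′ col j + column [ (r , c) ] col j) t (B ∸ t)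
      ≡⟨ colCount-+ B col t D′ _ ⟩
    count D′ col t + count [ (r , c) ] col t
      ∎

⇝-descent : ∀ {B X Y} → Bounded B X → X ⇝ Y → Descent B X Y
⇝-descent X<B (done X≈Y) = Descent-≈ X<B X≈Y
⇝-descent {X = X} X<B (move r moves) with kohnert-step r X
... | inj₁ same = Descent-trans X↘ (⇝-descent (bounded X↘) moves)
  where X↘ = Descent-≈ X<B λ x → ⇔-sym (same x)
... | inj₂ step = Descent-trans X↘ (⇝-descent (bounded X↘) moves)
  where X↘ = KohnertStep-descent X<B step

module _ {B : ℕ} {X E Y : Diagram} (X↘E : Descent B X E) (E↘Y : Descent B E Y) (col : ℕ) where

  colCount-squeeze : ∀ t → colCount B col t X ≡ colCount B col t Y →
                     colCount B col t E ≡ colCount B col t X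
  colCount-squeeze t X≡Y = ≤-antisym (colCount-≤ X↘E col t)
    (subst (_≤ colCount B col t E) (sym X≡Y) (colCount-≤ E↘Y col t))

  χ-squeeze : ∀ {ρ} → ρ < B →
    colCount B col ρ X ≡ colCount B col ρ Y → colCount B col (suc ρ) X ≡ colCount B col (suc ρ) Y →
    χ E (ρ , col) ≡ χ X (ρ , col)
  χ-squeeze {ρ} ρ<B X≡Yρ X≡Y1+ρ = +-cancelʳ-≡ (colCount B col (suc ρ) X) _ _ (begin
    χ E (ρ , col) + colCount B col (suc ρ) X
      ≡⟨ cong (χ E (ρ , col) +_) (sym (colCount-squeeze (suc ρ) X≡Y1+ρ)) ⟩
    χ E (ρ , col) + colCount B col (suc ρ) E
      ≡⟨ sym (colCount-suc col E ρ<B) ⟩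
    colCount B col ρ E
      ≡⟨ colCount-squeeze ρ X≡Yρ ⟩
    colCount B col ρ X
      ≡⟨ colCount-suc col X ρ<B ⟩
    χ X (ρ , col) + colCount B col (suc ρ) X
      ∎)

  colCount-total-≡ : colCount B col 0 X ≡ colCount B col 0 Y
  colCount-total-≡ = sym (trans (colCount-total E↘Y col) (colCount-total X↘E col))

  colCount-≡-above : ∀ t → (∀ j → t ≤ j → χ X (j , col) ≡ χ Y (j , col)) →
                     colCount B col t X ≡ colCount B col t Y
  colCount-≡-above t X≡Y = sumFrom-cong t (B ∸ t) λ j t≤j _ → X≡Y j t≤j

  colCount-≡-below : ∀ t → t ≤ B → (∀ j → j < t → χ X (j , col) ≡ χ Y (j , col)) →
                     colCount B col t X ≡ colCount B col t Y
  colCount-≡-below t t≤B X≡Y = +-cancelˡ-≡ (sumFrom (column X col) 0 t) _ _ (begin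
    sumFrom (column X col) 0 t + colCount B col t X  ≡⟨ sym (colCount-prefix col X t≤B) ⟩
    colCount B col 0 X                               ≡⟨ colCount-total-≡ ⟩
    colCount B col 0 Y                               ≡⟨ colCount-prefix col Y t≤B ⟩
    sumFrom (column Y col) 0 t + colCount B col t Y  ≡⟨ cong (_+ colCount B col t Y) (sym prefix≡) ⟩
    sumFrom (column X col) 0 t + colCount B col t Y  ∎)
    where
    prefix≡ : sumFrom (column X col) 0 t ≡ sumFrom (column Y col) 0 t
    prefix≡ = sumFrom-cong 0 t λ j _ j<t → X≡Y j j<t

AgreeAt : Diagram → Diagram → Cell → Set
AgreeAt X Y x = x ∈ X ⇔ x ∈ Y

interval-agree : ∀ {X E Y} → X ⇝ E → E ⇝ Y → ∀ ρ col →
  (∀ j → ρ ≤ j → AgreeAt X Y (j , col)) ⊎ (∀ j → j ≤ ρ → AgreeAt X Y (j , col)) →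
  AgreeAt E X (ρ , col)
interval-agree {X} {E} {Y} X⇝E E⇝Y ρ col agree with bound X
... | B , X<B with ρ <? B
...   | no ρ≮B =
  mk⇔ (λ ρ∈E → ⊥-elim (ρ≮B (bounded X↘E ρ∈E))) (λ ρ∈X → ⊥-elim (ρ≮B (X<B ρ∈X)))
  where X↘E = ⇝-descent X<B X⇝E
...   | yes ρ<B = χ-≡⇒⇔ (χ-squeeze X↘E E↘Y col ρ<B (proj₁ counts≡) (proj₂ counts≡))
  where
  X↘E = ⇝-descent X<B X⇝E
  E↘Y = ⇝-descent (bounded X↘E) E⇝Y
  CountsAgree : Set
  CountsAgree = colCount B col ρ X ≡ colCount B col ρ Y × colCount B col (suc ρ) X ≡ colCount B col (suc ρ) Y
  fromAbove : (∀ j → ρ ≤ j → AgreeAt X Y (j , col)) → CountsAgree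
  fromAbove above =
      colCount-≡-above X↘E E↘Y col ρ (λ j ρ≤j → χ-cong (above j ρ≤j))
    , colCount-≡-above X↘E E↘Y col (suc ρ) (λ j ρ<j → χ-cong (above j (<⇒≤ ρ<j)))
  fromBelow : (∀ j → j ≤ ρ → AgreeAt X Y (j , col)) → CountsAgree
  fromBelow below =
      colCount-≡-below X↘E E↘Y col ρ (<⇒≤ ρ<B) (λ j j<ρ → χ-cong (below j (<⇒≤ j<ρ)))
    , colCount-≡-below X↘E E↘Y col (suc ρ) ρ<B (λ j j≤ρ → χ-cong (below j (s≤s⁻¹ j≤ρ)))
  counts≡ : CountsAgree
  counts≡ = [ fromAbove , fromBelow ]′ agree

strictlyMonotone⇒injective : ∀ {n} (f : Fin n → ℕ) → (∀ i j → i Data.Fin.< j → f i < f j) →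
                             Injective _≡_ _≡_ f
strictlyMonotone⇒injective f f-mono {i} {j} fi≡fj with Fin-<-cmp i j
... | tri< i<j _ _ = ⊥-elim (<-irrefl fi≡fj (f-mono i j i<j))
... | tri≈ _ i≡j _ = i≡j
... | tri> _ _ j<i = ⊥-elim (<-irrefl (sym fi≡fj) (f-mono j i j<i))

InR-column : ∀ {n c r₁ r₂ i j col} → Injective _≡_ _≡_ c → col ≡ c i →
             InR n c r₁ r₂ (j , col) → r₁ i ≤ j × j ≤ r₂ i
InR-column c-inj col≡ci (i′ , col≡ci′ , r₁≤j , j≤r₂) with c-inj (trans (sym col≡ci) col≡ci′)
... | refl = r₁≤j , j≤r₂

InR-column-convex : ∀ n c r₁ r₂ → Injective _≡_ _≡_ c → ∀ {ρ col} → ¬ InR n c r₁ r₂ (ρ , col) →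
  (∀ j → ρ ≤ j → ¬ InR n c r₁ r₂ (j , col)) ⊎ (∀ j → j ≤ ρ → ¬ InR n c r₁ r₂ (j , col))
InR-column-convex n c r₁ r₂ c-inj {ρ} {col} ρ∉R with any? (λ i → col ≟ c i)
... | no col∉c = inj₁ λ { j _ (i , col≡ci , _) → col∉c (i , col≡ci) }
... | yes (i , col≡ci) with ρ <? r₁ i
...   | yes ρ<r₁ = inj₂ λ j j≤ρ j∈R →
  <⇒≱ ρ<r₁ (≤-trans (proj₁ (InR-column c-inj col≡ci j∈R)) j≤ρ)
...   | no ρ≮r₁ = inj₁ λ j ρ≤j j∈R →
  ρ∉R (i , col≡ci , ≮⇒≥ ρ≮r₁ , ≤-trans ρ≤j (proj₂ (InR-column c-inj col≡ci j∈R)))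

lemma3p3 : (D D₁ D₂ : Diagram) → Positive D →
    D₁ ∈𝒫 D → D₂ ∈𝒫 D → D₂ ≺ D₁ →
    (n : ℕ) (c r₁ r₂ : Fin n → ℕ) →
    (∀ i → 0 Data.Nat.< c i) → (∀ i j → i Data.Fin.< j → c i Data.Nat.< c j) →
    (∀ i → 0 Data.Nat.< r₁ i × r₁ i Data.Nat.< r₂ i) →
    (D₁ ∖ InR n c r₁ r₂) ≐ (D₂ ∖ InR n c r₁ r₂) →
    ∀ E → InInterval D D₂ D₁ E → (E ∖ InR n c r₁ r₂) ≐ (D₁ ∖ InR n c r₁ r₂)
lemma3p3 D D₁ D₂ _ _ _ _ n c r₁ r₂ _ c-mono _ D₁∖R≐D₂∖R E (_ , E⇝D₂ , D₁⇝E) (ρ , col) =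
  mk⇔ (λ (ρ∈E , ρ∉R) → Equivalence.to (E⇔D₁ ρ∉R) ρ∈E , ρ∉R)
      (λ (ρ∈D₁ , ρ∉R) → Equivalence.from (E⇔D₁ ρ∉R) ρ∈D₁ , ρ∉R)
  where
  R = InR n c r₁ r₂
  D₁⇔D₂ : ∀ {x} → ¬ R x → AgreeAt D₁ D₂ x
  D₁⇔D₂ x∉R = mk⇔ (λ x∈D₁ → proj₁ (Equivalence.to (D₁∖R≐D₂∖R _) (x∈D₁ , x∉R)))
                  (λ x∈D₂ → proj₁ (Equivalence.from (D₁∖R≐D₂∖R _) (x∈D₂ , x∉R)))
  E⇔D₁ : ¬ R (ρ , col) → AgreeAt E D₁ (ρ , col)
  E⇔D₁ ρ∉R = interval-agree D₁⇝E E⇝D₂ ρ col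
    (⊎-map (λ above j ρ≤j → D₁⇔D₂ (above j ρ≤j)) (λ below j j≤ρ → D₁⇔D₂ (below j j≤ρ))
      (InR-column-convex n c r₁ r₂ (strictlyMonotone⇒injective c c-mono) ρ∉R))
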